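{- Let $(n_1,\dots,n_r)$ be a sequence of non-negative integers with $\sum n_i=n$. Then $$SH(n_1,\dots,n_r)=\{\omega\in\mathcal P_n : \omega\le_B\xi_{n_1,\dots,n_r}\}.$$
   Context: For $n\ge1$, $\mathcal P_n$ is the set of surjective maps $\gamma:\{1,\dots,n\}\to\{1,\dots,r\}$ ($r\ge1$), $\mathcal P_{n,r}$ those with image $\{1,\dots,r\}$; write $\gamma=(\gamma(1),\dots,\gamma(n))$. For $r\ge2$ and $1\le i\le r-1$, $t_i\in\mathcal P_{r,r-1}$ is $t_i(j)=j$ for $j\le i$, $t_i(j)=j-1$ for $j>i$. For $\gamma\in\mathcal P_{n,r}$, write $\gamma^{ -1}(i)<\gamma^{ -1}(i+1)$ if every element of $\gamma^{ -1}(i)$ is smaller than every element of $\gamma^{ -1}(i+1)$. The weak Bruhat order $\le_B$ on $\mathcal P_n$ is the reflexive transitive closure of: $\gamma<_B t_i\circ\gamma$ whenever $\gamma^{ -1}(i)<\gamma^{ -1}(i+1)$, and $t_i\circ\gamma<_B\gamma$ whenever $\gamma^{ -1}(i)>\gamma^{ -1}(i+1)$. $SH(n_1,\dots,n_r)$ is the set of $\gamma\in\mathcal P_n$ strictly increasing on each block $B_j=\{n_1+\dots+n_{j-1}+1,\dots,n_1+\dots+n_j\}$. $\xi_{n_1,\dots,n_r}$ is the permutation of $\{1,\dots,n\}$ given by $\xi(k)=k-\sum_{i<j}n_i+\sum_{i>j}n_i$ for $k\in B_j$. -}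

module Defs where

open import Data.Nat as ℕ using (ℕ; zero; suc; _+_; _∸_; z≤n; s≤s)
open import Data.Nat.Properties using (+-monoˡ-<; ≤-trans; m≤n+m; ≮⇒≥)
open import Data.Fin as F using (Fin; toℕ; fromℕ<; inject₁)
open import Data.List using (List; []; _∷_)
open import Data.Nat.ListAction using (sum)
open import Data.Vec using (Vec; lookup; map; tabulate)
open import Data.Vec.Membership.Propositional using (_∈_)
open import Data.Fin.Properties using (toℕ<n)
open import Data.Product using (Σ; _,_)
open import Relation.Binary.PropositionalEquality using (_≡_)
open import Relation.Nullary using (yes; no)
open import Relation.Binary.Construct.Closure.ReflexiveTransitive using (Star)

-- Everything is 0-based: {1,…,n} is Fin n, value j+1 of the paper is Fin-value j.

Map : ℕ → Set
Map n = Σ ℕ (λ r → Vec (Fin r) n)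

-- surjectivity; P_n = { γ : Map n | Surj γ }
Surj : ∀ {n} → Map n → Set
Surj (r , γ) = ∀ (j : Fin r) → j ∈ γ

-- t_i : {1..r} → {1..r-1}  (r = suc r', i ∈ {1..r-1} encoded as i : Fin r')
-- t_i(j) = j for j ≤ i, j-1 for j > i  (0-based: same rule).
t : ∀ {r'} → Fin r' → Fin (suc r') → Fin r'
t {suc r'} i F.zero = F.zero
t {suc r'} F.zero (F.suc j) = j
t {suc r'} (F.suc i) (F.suc j) = F.suc (t i j)

PreLt : ∀ {n r} → Vec (Fin r) n → Fin r → Fin r → Set
PreLt {n} γ a b = ∀ (k l : Fin n) → lookup γ k ≡ a → lookup γ l ≡ b → k F.< l

-- generating relation of the weak Bruhat order on P_n
-- (paper's i and i+1 are inject₁ i and suc i here)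
data _⋖_ {n : ℕ} : Map n → Map n → Set where
  up   : ∀ {r'} (γ : Vec (Fin (suc r')) n) (i : Fin r') → Surj (suc r' , γ) →
         PreLt γ (inject₁ i) (F.suc i) → (suc r' , γ) ⋖ (r' , map (t i) γ)
  down : ∀ {r'} (γ : Vec (Fin (suc r')) n) (i : Fin r') → Surj (suc r' , γ) →
         PreLt γ (F.suc i) (inject₁ i) → (r' , map (t i) γ) ⋖ (suc r' , γ)

_≤B_ : ∀ {n} → Map n → Map n → Set
_≤B_ = Star _⋖_

blk : List ℕ → ℕ → ℕ
blk [] k = zero
blk (m ∷ ms) k with k ℕ.<? m
... | yes _ = zero
... | no  _ = suc (blk ms (k ∸ m))

SH : (ns : List ℕ) → Map (sum ns) → Set
SH ns (r , γ) = ∀ (k l : Fin (sum ns)) → k F.< l →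
  blk ns (toℕ k) ≡ blk ns (toℕ l) → lookup γ k F.< lookup γ l

-- ξ(k) = k - Σ_{i<j} n_i + Σ_{i>j} n_i for k ∈ B_j (0-based positions/values)
xiℕ : List ℕ → ℕ → ℕ
xiℕ [] k = k
xiℕ (m ∷ ms) k with k ℕ.<? m
... | yes _ = k + sum ms
... | no  _ = xiℕ ms (k ∸ m)

xiℕ-< : ∀ ns k → k ℕ.< sum ns → xiℕ ns k ℕ.< sum ns
xiℕ-< [] k p = p
xiℕ-< (m ∷ ms) k p with k ℕ.<? m
... | yes q = +-monoˡ-< (sum ms) q
... | no  q = ≤-trans (xiℕ-< ms (k ∸ m) (sub-lt {k} {m} p' (≮⇒≥ q)))
                      (m≤n+m (sum ms) m)
  where
  p' : k ℕ.< m + sum ms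
  p' = p
  sub-lt : ∀ {k m} → k ℕ.< m + sum ms → m ℕ.≤ k → k ∸ m ℕ.< sum ms
  sub-lt {k} {zero} a _ = a
  sub-lt {suc k} {suc m} (s≤s a) (s≤s b) = sub-lt {k} {m} a b

ξ : (ns : List ℕ) → Map (sum ns)
ξ ns = sum ns , tabulate (λ k → fromℕ< (xiℕ-< ns (toℕ k) (toℕ<n k)))

{-# OPTIONS --safe #-}

-- A cover ω ⋖ ω′ can only turn ascents of ω into ties and ties into descents (ω ⊑ ω′).
-- Hence SH, which asks for strict ascents inside each block, passes from ξ down to
-- everything below it. Conversely, an SH map ω ≠ ξ has a cover that is again in SH:
-- split a tie, sending the earlier positions to the upper value, or, if ω is injective,
-- merge two consecutive values whose positions lie in increasing blocks. If neither
-- applies, ω is increasing inside blocks and decreasing across them, like ξ, and two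
-- surjections with the same order type coincide. Every cover lowers the weighted
-- number of ascents, so climbing this way reaches ξ.
module Submission where

open import Defs
open import Data.Nat using (ℕ; _≤_)
open import Data.List using (List; []; _∷_)
open import Data.Nat.ListAction using (sum)
open import Function.Bundles using (_⇔_; mk⇔)

open import Algebra.Properties.Monoid.Sum as Sum using ()
open import Data.Empty using (⊥-elim)
open import Data.Fin as F using (Fin; zero; suc; toℕ; fromℕ<; inject₁; punchIn; pinch)
open import Data.Fin.Properties as F
  using (toℕ-injective; toℕ-fromℕ<; toℕ<n; punchInᵢ≢i; pinch-mono-≤; pinch-surjective; any?)
open import Data.Nat as ℕ using (_<_; _<?_; z≤n; s≤s; _∸_; _+_)
open import Data.Nat.Induction using (<-wellFounded)
open import Data.Nat.Properties as ℕ using (+-0-monoid)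
open import Data.Product as Product using (Σ; ∃; ∃₂; _×_; _,_; proj₁; proj₂)
open import Data.Sum using (_⊎_; inj₁; inj₂)
open import Data.Vec using (Vec; lookup; map; tabulate)
open import Data.Vec.Properties using (lookup-map; lookup∘tabulate; tabulate∘lookup; tabulate-cong)
open import Data.Vec.Membership.Propositional using (_∈_)
open import Data.Vec.Membership.Propositional.Properties using (∈-lookup; ∈-map⁺)
open import Data.Vec.Relation.Unary.Any using (index)
open import Data.Vec.Relation.Unary.Any.Properties using (lookup-index)
open import Function using (_∘_)
open import Induction.WellFounded using (Acc; acc)
open import Relation.Binary.Construct.Closure.ReflexiveTransitive using (ε; _◅_)
open import Relation.Binary.Definitions using (tri<; tri≈; tri>)
open import Relation.Binary.PropositionalEquality
  using (_≡_; _≢_; refl; sym; trans; cong; subst; subst₂; _≗_; module ≡-Reasoning)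
open import Relation.Nullary using (¬_; Dec; yes; no)
open import Relation.Nullary.Decidable using (_×-dec_)

open Sum +-0-monoid using (sum-syntax) renaming (sum to ∑)

private
  variable
    n r : ℕ

-- Pinching adjacent values

t≗pinch : (i : Fin r) → t i ≗ pinch i
t≗pinch zero    zero    = refl
t≗pinch (suc i) zero    = refl
t≗pinch zero    (suc j) = refl
t≗pinch (suc i) (suc j) = cong suc (t≗pinch i j)

punchIn-inject₁-self : (i : Fin r) → punchIn (inject₁ i) i ≡ suc i
punchIn-inject₁-self zero    = refl
punchIn-inject₁-self (suc i) = cong suc (punchIn-inject₁-self i)

punchIn-suc-self : (i : Fin r) → punchIn (suc i) i ≡ inject₁ i
punchIn-suc-self zero    = refl
punchIn-suc-self (suc i) = cong suc (punchIn-suc-self i)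

pinch-punchIn-inject₁ : (i j : Fin r) → pinch i (punchIn (inject₁ i) j) ≡ j
pinch-punchIn-inject₁ zero    j       = refl
pinch-punchIn-inject₁ (suc i) zero    = refl
pinch-punchIn-inject₁ (suc i) (suc j) = cong suc (pinch-punchIn-inject₁ i j)

pinch-punchIn-suc : (i j : Fin r) → pinch i (punchIn (suc i) j) ≡ j
pinch-punchIn-suc zero    zero    = refl
pinch-punchIn-suc zero    (suc j) = refl
pinch-punchIn-suc (suc i) zero    = refl
pinch-punchIn-suc (suc i) (suc j) = cong suc (pinch-punchIn-suc i j)

inject₁<suc : (i : Fin r) → inject₁ i F.< suc i
inject₁<suc i = F.≤̄⇒inject₁< ℕ.≤-refl

pinch-inject₁ : (i : Fin r) → pinch i (inject₁ i) ≡ i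
pinch-inject₁ i = trans (cong (pinch i) (sym (punchIn-suc-self i))) (pinch-punchIn-suc i i)

pinch-suc : (i : Fin r) → pinch i (suc i) ≡ i
pinch-suc i = trans (cong (pinch i) (sym (punchIn-inject₁-self i))) (pinch-punchIn-inject₁ i i)

pinch-identifies : (i : Fin r) {j k : Fin (ℕ.suc r)} → j F.< k → pinch i j ≡ pinch i k →
                   j ≡ inject₁ i × k ≡ suc i
pinch-identifies zero    {zero}  {suc zero}    _   _    = refl , refl
pinch-identifies zero    {zero}  {suc (suc k)} _   ()
pinch-identifies zero    {suc j} {suc k}       j<k refl = ⊥-elim (ℕ.<-irrefl refl (ℕ.s≤s⁻¹ j<k))
pinch-identifies (suc i) {zero}  {suc k}       _   ()
pinch-identifies (suc i) {suc j} {suc k}       j<k eq   =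
  Product.map (cong suc) (cong suc) (pinch-identifies i (ℕ.s≤s⁻¹ j<k) (F.suc-injective eq))

pinch-mono-< : (i : Fin r) {j k : Fin (ℕ.suc r)} → j F.< k → ¬ (j ≡ inject₁ i × k ≡ suc i) →
               pinch i j F.< pinch i k
pinch-mono-< i j<k ¬ends = F.≤∧≢⇒< (pinch-mono-≤ i (ℕ.<⇒≤ j<k)) (¬ends ∘ pinch-identifies i j<k)

pinch-reflects-< : (i : Fin r) {j k : Fin (ℕ.suc r)} → pinch i j F.< pinch i k → j F.< k
pinch-reflects-< i lt = ℕ.≰⇒> λ k≤j → ℕ.<⇒≱ lt (pinch-mono-≤ i k≤j)

adjacent⇒pinched : {a b : Fin (ℕ.suc r)} → toℕ b ≡ ℕ.suc (toℕ a) →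
                   Σ (Fin r) λ i → a ≡ inject₁ i × b ≡ suc i
adjacent⇒pinched {a = zero}  {suc zero}    refl = zero , refl , refl
adjacent⇒pinched {a = suc a} {suc (suc b)} eq   with adjacent⇒pinched {a = a} {suc b} (ℕ.suc-injective eq)
... | i , refl , refl = suc i , refl , refl

-- Order-isomorphic rank functions

module _ {a} {A : Set a} where

  DownClosed : (A → ℕ) → Set a
  DownClosed f = ∀ {k v} → v < f k → ∃ λ l → f l ≡ v

  rank-≤ : (f g : A → ℕ) → DownClosed f → (∀ {k l} → f k < f l → g k < g l) → ∀ k → f k ≤ g k
  rank-≤ f g closed mono k = go (f k) k refl
    where
    go : ∀ v k → f k ≡ v → v ≤ g k
    go ℕ.zero    k _    = z≤n
    go (ℕ.suc v) k fk≡ with closed (subst (v <_) (sym fk≡) ℕ.≤-refl)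
    ... | l , fl≡v = ℕ.≤-<-trans (go v l fl≡v) (mono (subst₂ _<_ (sym fl≡v) (sym fk≡) ℕ.≤-refl))

  rank-unique : {f g : A → ℕ} → DownClosed f → DownClosed g →
                (∀ {k l} → f k < f l → g k < g l) → (∀ {k l} → g k < g l → f k < f l) → f ≗ g
  rank-unique {f} {g} closed-f closed-g f⇒g g⇒f k =
    ℕ.≤-antisym (rank-≤ f g closed-f f⇒g k) (rank-≤ g f closed-g g⇒f k)

-- Surjective maps

values : Map n → Fin n → ℕ
values (_ , γ) k = toℕ (lookup γ k)

preimage : {γ : Vec (Fin r) n} → Surj (r , γ) → ∀ j → ∃ λ k → lookup γ k ≡ j
preimage surj j = index (surj j) , sym (lookup-index (surj j))

Surj⇒DownClosed : {ω : Map n} → Surj ω → DownClosed (values ω)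
Surj⇒DownClosed {ω = r , γ} surj {k} v<γk
  with preimage surj (fromℕ< (ℕ.<-trans v<γk (toℕ<n (lookup γ k))))
... | l , γl≡v = l , trans (cong toℕ γl≡v) (toℕ-fromℕ< _)

Surj-map : ∀ {s} {f : Fin r → Fin s} → (∀ j → ∃ λ i → f i ≡ j) →
           (γ : Vec (Fin r) n) → Surj (r , γ) → Surj (s , map f γ)
Surj-map {f = f} f-onto γ surj j with f-onto j
... | i , fi≡j = subst (_∈ map f γ) fi≡j (∈-map⁺ f (surj i))

lookup-map-t : (i : Fin r) (γ : Vec (Fin (ℕ.suc r)) n) (k : Fin n) →
               lookup (map (t i) γ) k ≡ pinch i (lookup γ k)
lookup-map-t i γ k = trans (lookup-map k (t i) γ) (t≗pinch i (lookup γ k))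

t-onto : (i : Fin r) → ∀ j → ∃ λ k → t i k ≡ j
t-onto i j with pinch-surjective i j
... | k , pinch-k≡j = k , trans (t≗pinch i k) (pinch-k≡j refl)

Surj-unpinch : (i : Fin r) (δ : Vec (Fin (ℕ.suc r)) n) → Surj (r , map (t i) δ) →
               inject₁ i ∈ δ → suc i ∈ δ → Surj (ℕ.suc r , δ)
Surj-unpinch i δ surj i∈δ 1+i∈δ w with w F.≟ inject₁ i | w F.≟ suc i
... | yes refl | _        = i∈δ
... | no _     | yes refl = 1+i∈δ
... | no w≢i   | no w≢1+i with preimage surj (pinch i w)
...   | p , eq = subst (_∈ δ) δp≡w (∈-lookup p δ)
  where
  same : pinch i (lookup δ p) ≡ pinch i w
  same = trans (sym (lookup-map-t i δ p)) eq
  δp≡w : lookup δ p ≡ w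
  δp≡w with F.<-cmp (lookup δ p) w
  ... | tri< lt _ _ = ⊥-elim (w≢1+i (proj₂ (pinch-identifies i lt same)))
  ... | tri≈ _ eq _ = eq
  ... | tri> _ _ gt = ⊥-elim (w≢i (proj₁ (pinch-identifies i gt (sym same))))

lookup-ext : {xs ys : Vec (Fin r) n} → (∀ k → lookup xs k ≡ lookup ys k) → xs ≡ ys
lookup-ext {xs = xs} {ys} eq =
  trans (sym (tabulate∘lookup xs)) (trans (tabulate-cong eq) (tabulate∘lookup ys))

Surj-codomain-≤ : {ω ω′ : Map n} → Surj ω′ → values ω ≗ values ω′ → proj₁ ω′ ≤ proj₁ ω
Surj-codomain-≤ {ω = r , γ} {s , δ} surj eq = ℕ.≮⇒≥ r≮s
  where
  r≮s : ¬ r < s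
  r≮s r<s with preimage surj (fromℕ< r<s)
  ... | k , δk≡r =
    ℕ.<-irrefl (trans (eq k) (trans (cong toℕ δk≡r) (toℕ-fromℕ< r<s))) (toℕ<n (lookup γ k))

Surj-≡ : {ω ω′ : Map n} → Surj ω → Surj ω′ → values ω ≗ values ω′ → ω ≡ ω′
Surj-≡ {ω = r , γ} {s , δ} surj surj′ eq
  with ℕ.≤-antisym (Surj-codomain-≤ {ω = r , γ} surj′ eq)
                   (Surj-codomain-≤ {ω = s , δ} surj (sym ∘ eq))
... | refl = cong (r ,_) (lookup-ext (toℕ-injective ∘ eq))

-- Covers remove ascents

record _⊑_ (ω ω′ : Map n) : Set where
  field
    reflects-< : ∀ {k l} → k F.< l → values ω′ k < values ω′ l → values ω k < values ω l
    reflects-≤ : ∀ {k l} → k F.< l → values ω′ k ≤ values ω′ l → values ω k ≤ values ω l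

open _⊑_

⋖⇒⊑ : {ω ω′ : Map n} → ω ⋖ ω′ → ω ⊑ ω′
reflects-< (⋖⇒⊑ (up γ i _ _)) {k} {l} _ rewrite lookup-map-t i γ k | lookup-map-t i γ l =
  pinch-reflects-< i
reflects-≤ (⋖⇒⊑ (up γ i _ pre)) {k} {l} k<l rewrite lookup-map-t i γ k | lookup-map-t i γ l =
  λ pinch≤ → ℕ.≮⇒≥ λ γl<γk →
    ℕ.<⇒≱ (pinch-mono-< i γl<γk λ (γl≡i , γk≡1+i) → ℕ.<-asym k<l (pre l k γl≡i γk≡1+i)) pinch≤
reflects-< (⋖⇒⊑ (down γ i _ pre)) {k} {l} k<l rewrite lookup-map-t i γ k | lookup-map-t i γ l =
  λ γk<γl → pinch-mono-< i γk<γl λ (γk≡i , γl≡1+i) → ℕ.<-asym k<l (pre l k γl≡1+i γk≡i)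
reflects-≤ (⋖⇒⊑ (down γ i _ _)) {k} {l} _ rewrite lookup-map-t i γ k | lookup-map-t i γ l =
  pinch-mono-≤ i

𝟙 : ∀ {p} {P : Set p} → Dec P → ℕ
𝟙 (yes _) = 1
𝟙 (no _)  = 0

𝟙-mono : ∀ {p q} {P : Set p} {Q : Set q} → (P → Q) → (P? : Dec P) (Q? : Dec Q) → 𝟙 P? ≤ 𝟙 Q?
𝟙-mono P⇒Q (yes p) (yes _) = ℕ.≤-refl
𝟙-mono P⇒Q (yes p) (no ¬q) = ⊥-elim (¬q (P⇒Q p))
𝟙-mono P⇒Q (no _)  _       = z≤n

𝟙-mono-< : ∀ {p q} {P : Set p} {Q : Set q} → ¬ P → Q → (P? : Dec P) (Q? : Dec Q) → 𝟙 P? < 𝟙 Q?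
𝟙-mono-< ¬p q (yes p) _       = ⊥-elim (¬p p)
𝟙-mono-< ¬p q (no _)  (yes _) = ℕ.≤-refl
𝟙-mono-< ¬p q (no _)  (no ¬q) = ⊥-elim (¬q q)

∑-mono-≤ : {f g : Fin n → ℕ} → (∀ i → f i ≤ g i) → ∑ f ≤ ∑ g
∑-mono-≤ {ℕ.zero}  _   = z≤n
∑-mono-≤ {ℕ.suc n} f≤g = ℕ.+-mono-≤ (f≤g zero) (∑-mono-≤ (f≤g ∘ suc))

∑-mono-< : {f g : Fin n → ℕ} → (∀ i → f i ≤ g i) → ∀ {j} → f j < g j → ∑ f < ∑ g
∑-mono-< {ℕ.suc n} f≤g {zero}  fj<gj = ℕ.+-mono-<-≤ fj<gj (∑-mono-≤ (f≤g ∘ suc))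
∑-mono-< {ℕ.suc n} f≤g {suc j} fj<gj = ℕ.+-mono-≤-< (f≤g zero) (∑-mono-< (f≤g ∘ suc) fj<gj)

ascent? : (γ : Vec (Fin r) n) (k l : Fin n) → Dec (k F.< l × lookup γ k F.< lookup γ l)
ascent? γ k l = k F.<? l ×-dec lookup γ k F.<? lookup γ l

weakAscent? : (γ : Vec (Fin r) n) (k l : Fin n) → Dec (k F.< l × lookup γ k F.≤ lookup γ l)
weakAscent? γ k l = k F.<? l ×-dec lookup γ k F.≤? lookup γ l

ascentWeight : Map n → Fin n → Fin n → ℕ
ascentWeight (_ , γ) k l = 𝟙 (ascent? γ k l) + 𝟙 (weakAscent? γ k l)

ascents : Map n → ℕ
ascents {n} ω = ∑[ k < n ] ∑[ l < n ] ascentWeight ω k l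

ascentWeight-mono : {ω ω′ : Map n} → ω ⊑ ω′ → ∀ k l → ascentWeight ω′ k l ≤ ascentWeight ω k l
ascentWeight-mono {ω = _ , γ} {_ , δ} ω⊑ω′ k l = ℕ.+-mono-≤
  (𝟙-mono (λ (k<l , lt) → k<l , reflects-< ω⊑ω′ k<l lt) (ascent? δ k l) (ascent? γ k l))
  (𝟙-mono (λ (k<l , le) → k<l , reflects-≤ ω⊑ω′ k<l le) (weakAscent? δ k l) (weakAscent? γ k l))

ascentWeight-< : {ω ω′ : Map n} → ω ⊑ ω′ → ∀ {k l} → k F.< l →
  (values ω k < values ω l × ¬ values ω′ k < values ω′ l) ⊎
  (values ω k ≤ values ω l × ¬ values ω′ k ≤ values ω′ l) →
  ascentWeight ω′ k l < ascentWeight ω k l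
ascentWeight-< {ω = _ , γ} {_ , δ} ω⊑ω′ {k} {l} k<l (inj₁ (lt , ¬lt′)) = ℕ.+-mono-<-≤
  (𝟙-mono-< (¬lt′ ∘ proj₂) (k<l , lt) (ascent? δ k l) (ascent? γ k l))
  (𝟙-mono (λ (k<l , le) → k<l , reflects-≤ ω⊑ω′ k<l le) (weakAscent? δ k l) (weakAscent? γ k l))
ascentWeight-< {ω = _ , γ} {_ , δ} ω⊑ω′ {k} {l} k<l (inj₂ (le , ¬le′)) = ℕ.+-mono-≤-<
  (𝟙-mono (λ (k<l , lt) → k<l , reflects-< ω⊑ω′ k<l lt) (ascent? δ k l) (ascent? γ k l))
  (𝟙-mono-< (¬le′ ∘ proj₂) (k<l , le) (weakAscent? δ k l) (weakAscent? γ k l))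

ascents-< : {ω ω′ : Map n} → ω ⊑ ω′ → ∀ {k l} → ascentWeight ω′ k l < ascentWeight ω k l →
            ascents ω′ < ascents ω
ascents-< ω⊑ω′ {k} {l} lt = ∑-mono-< (λ k′ → ∑-mono-≤ (ascentWeight-mono ω⊑ω′ k′)) {k}
  (∑-mono-< (ascentWeight-mono ω⊑ω′ k) {l} lt)

pinch-ties : (i : Fin r) (γ : Vec (Fin (ℕ.suc r)) n) {p q : Fin n} →
             lookup γ p ≡ inject₁ i → lookup γ q ≡ suc i →
             lookup (map (t i) γ) p ≡ lookup (map (t i) γ) q
pinch-ties i γ {p} {q} γp γq = begin
  lookup (map (t i) γ) p  ≡⟨ lookup-map-t i γ p ⟩
  pinch i (lookup γ p)    ≡⟨ cong (pinch i) γp ⟩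
  pinch i (inject₁ i)     ≡⟨ trans (pinch-inject₁ i) (sym (pinch-suc i)) ⟩
  pinch i (suc i)         ≡⟨ cong (pinch i) (sym γq) ⟩
  pinch i (lookup γ q)    ≡⟨ sym (lookup-map-t i γ q) ⟩
  lookup (map (t i) γ) q  ∎
  where open ≡-Reasoning

⋖-decreases : {ω ω′ : Map n} → ω ⋖ ω′ → ascents ω′ < ascents ω
⋖-decreases ω⋖ω′@(up γ i surj pre) with preimage surj (inject₁ i) | preimage surj (suc i)
... | p , γp | q , γq = ascents-< (⋖⇒⊑ ω⋖ω′) {p} {q}
  (ascentWeight-< (⋖⇒⊑ ω⋖ω′) (pre p q γp γq) (inj₁ (ascent , ¬ascent′)))
  where
  ascent : lookup γ p F.< lookup γ q
  ascent = subst₂ F._<_ (sym γp) (sym γq) (inject₁<suc i)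
  ¬ascent′ : ¬ lookup (map (t i) γ) p F.< lookup (map (t i) γ) q
  ¬ascent′ = ℕ.<-irrefl (cong toℕ (pinch-ties i γ γp γq))
⋖-decreases ω⋖ω′@(down γ i surj pre) with preimage surj (suc i) | preimage surj (inject₁ i)
... | p , γp | q , γq = ascents-< (⋖⇒⊑ ω⋖ω′) {p} {q}
  (ascentWeight-< (⋖⇒⊑ ω⋖ω′) (pre p q γp γq) (inj₂ (tie , ¬weak′)))
  where
  tie : lookup (map (t i) γ) p F.≤ lookup (map (t i) γ) q
  tie = ℕ.≤-reflexive (cong toℕ (sym (pinch-ties i γ γq γp)))
  ¬weak′ : ¬ lookup γ p F.≤ lookup γ q
  ¬weak′ = ℕ.<⇒≱ (subst₂ F._<_ (sym γq) (sym γp) (inject₁<suc i))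

-- Blocks and ξ

block : (ns : List ℕ) → Fin (sum ns) → ℕ
block ns k = blk ns (toℕ k)

blk-mono : ∀ ns {x y} → x ≤ y → blk ns x ≤ blk ns y
blk-mono []       _ = z≤n
blk-mono (m ∷ ms) {x} {y} x≤y with x <? m | y <? m
... | yes _   | _       = z≤n
... | no x≮m  | yes y<m = ⊥-elim (x≮m (ℕ.≤-<-trans x≤y y<m))
... | no _    | no _    = s≤s (blk-mono ms (ℕ.∸-monoˡ-≤ m x≤y))

block-reflects-< : ∀ ns {k l} → block ns k < block ns l → k F.< l
block-reflects-< ns lt = ℕ.≰⇒> λ l≤k → ℕ.<⇒≱ lt (blk-mono ns l≤k)

-- The order type of ξ: increasing inside each block, decreasing across blocks.
BlockOrdered : (Fin n → ℕ) → (Fin n → ℕ) → Set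
BlockOrdered b f = ∀ {k l} → k F.< l → (b k ≡ b l → f k < f l) × (b k ≢ b l → f l < f k)

BlockOrdered-< : {b f g : Fin n → ℕ} → BlockOrdered b f → BlockOrdered b g →
                 ∀ {k l} → f k < f l → g k < g l
BlockOrdered-< {b = b} ord-f ord-g {k} {l} fk<fl with F.<-cmp k l | b k ℕ.≟ b l
... | tri< k<l _ _ | yes same = proj₁ (ord-g k<l) same
... | tri< k<l _ _ | no diff  = ⊥-elim (ℕ.<-asym fk<fl (proj₂ (ord-f k<l) diff))
... | tri≈ _ refl _ | _       = ⊥-elim (ℕ.<-irrefl refl fk<fl)
... | tri> _ _ l<k | yes same = ⊥-elim (ℕ.<-asym fk<fl (proj₁ (ord-f l<k) (sym same)))
... | tri> _ _ l<k | no diff  = proj₂ (ord-g l<k) (diff ∘ sym)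

m<n+o∧n≤m⇒m∸n<o : ∀ {m n o} → m < n + o → n ≤ m → m ∸ n < o
m<n+o∧n≤m⇒m∸n<o {m} {n} {o} m<n+o n≤m =
  subst (m ∸ n <_) (ℕ.m+n∸m≡n n o) (ℕ.∸-monoˡ-< m<n+o n≤m)

xiℕ-blockOrdered : ∀ ns {k l} → k < l → l < sum ns →
  (blk ns k ≡ blk ns l → xiℕ ns k < xiℕ ns l) × (blk ns k ≢ blk ns l → xiℕ ns l < xiℕ ns k)
xiℕ-blockOrdered []       _   ()
xiℕ-blockOrdered (m ∷ ms) {k} {l} k<l l<Σ with k <? m | l <? m
... | yes _   | yes _   = (λ _ → ℕ.+-monoˡ-< (sum ms) k<l) , (λ diff → ⊥-elim (diff refl))
... | yes _   | no l≮m  = (λ ()) , λ _ →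
  ℕ.<-≤-trans (xiℕ-< ms (l ∸ m) (m<n+o∧n≤m⇒m∸n<o l<Σ (ℕ.≮⇒≥ l≮m))) (ℕ.m≤n+m (sum ms) k)
... | no k≮m  | yes l<m = ⊥-elim (k≮m (ℕ.<-trans k<l l<m))
... | no k≮m  | no l≮m  = Product.map (_∘ ℕ.suc-injective) (λ f diff → f (diff ∘ cong ℕ.suc))
  (xiℕ-blockOrdered ms (ℕ.∸-monoˡ-< k<l (ℕ.≮⇒≥ k≮m)) (m<n+o∧n≤m⇒m∸n<o l<Σ (ℕ.≮⇒≥ l≮m)))

xiℕ-head : ∀ m ms {k} → k < m → xiℕ (m ∷ ms) k ≡ k + sum ms
xiℕ-head m ms {k} k<m with k <? m
... | yes _   = refl
... | no k≮m = ⊥-elim (k≮m k<m)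

xiℕ-tail : ∀ m ms k → xiℕ (m ∷ ms) (m + k) ≡ xiℕ ms k
xiℕ-tail m ms k with m + k <? m
... | yes m+k<m = ⊥-elim (ℕ.<⇒≱ m+k<m (ℕ.m≤m+n m k))
... | no _      = cong (xiℕ ms) (ℕ.m+n∸m≡n m k)

xiℕ-onto : ∀ ns {v} → v < sum ns → ∃ λ k → k < sum ns × xiℕ ns k ≡ v
xiℕ-onto []       ()
xiℕ-onto (m ∷ ms) {v} v<Σ with v <? sum ms
... | yes v<Σms with xiℕ-onto ms v<Σms
...   | k , k<Σms , ξk≡v = m + k , ℕ.+-monoʳ-< m k<Σms , trans (xiℕ-tail m ms k) ξk≡v
xiℕ-onto (m ∷ ms) {v} v<Σ | no v≮Σms =
  v ∸ sum ms , ℕ.<-≤-trans v∸Σms<m (ℕ.m≤m+n m (sum ms)) ,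
  trans (xiℕ-head m ms v∸Σms<m) (ℕ.m∸n+n≡m (ℕ.≮⇒≥ v≮Σms))
  where
  v∸Σms<m : v ∸ sum ms < m
  v∸Σms<m = m<n+o∧n≤m⇒m∸n<o (subst (v <_) (ℕ.+-comm m (sum ms)) v<Σ) (ℕ.≮⇒≥ v≮Σms)

values-ξ : ∀ ns k → values (ξ ns) k ≡ xiℕ ns (toℕ k)
values-ξ ns k = trans (cong toℕ (lookup∘tabulate _ k)) (toℕ-fromℕ< _)

ξ-blockOrdered : ∀ ns → BlockOrdered (block ns) (values (ξ ns))
ξ-blockOrdered ns {k} {l} k<l rewrite values-ξ ns k | values-ξ ns l =
  xiℕ-blockOrdered ns k<l (toℕ<n l)

ξ-surjective : ∀ ns → Surj (ξ ns)
ξ-surjective ns j with xiℕ-onto ns (toℕ<n j)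
... | k , k<Σ , ξk≡j = subst (_∈ proj₂ (ξ ns)) ξk′≡j (∈-lookup k′ (proj₂ (ξ ns)))
  where
  k′ : Fin (sum ns)
  k′ = fromℕ< k<Σ
  ξk′≡j : lookup (proj₂ (ξ ns)) k′ ≡ j
  ξk′≡j = toℕ-injective (trans (values-ξ ns k′) (trans (cong (xiℕ ns) (toℕ-fromℕ< k<Σ)) ξk≡j))

SH-ξ : ∀ ns → SH ns (ξ ns)
SH-ξ ns k l k<l same = proj₁ (ξ-blockOrdered ns k<l) same

ξ-unique : ∀ ns {ω : Map (sum ns)} → Surj ω → BlockOrdered (block ns) (values ω) → ω ≡ ξ ns
ξ-unique ns surj ord = Surj-≡ surj (ξ-surjective ns)
  (rank-unique (Surj⇒DownClosed surj) (Surj⇒DownClosed (ξ-surjective ns))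
    (BlockOrdered-< ord (ξ-blockOrdered ns)) (BlockOrdered-< (ξ-blockOrdered ns) ord))

-- Climbing to ξ inside SH

SH-⊑ : ∀ ns {ω ω′ : Map (sum ns)} → ω ⊑ ω′ → SH ns ω′ → SH ns ω
SH-⊑ ns {_ , _} {_ , _} ω⊑ω′ sh k l k<l same = reflects-< ω⊑ω′ k<l (sh k l k<l same)

SH-unpinch : ∀ ns (i : Fin r) (δ : Vec (Fin (ℕ.suc r)) (sum ns)) →
             SH ns (r , map (t i) δ) → SH ns (ℕ.suc r , δ)
SH-unpinch ns i δ sh k l k<l same with sh k l k<l same
... | lt rewrite lookup-map-t i δ k | lookup-map-t i δ l = pinch-reflects-< i lt

SHCover : ∀ ns → Map (sum ns) → Set
SHCover ns ω = ∃ λ ω′ → ω ⋖ ω′ × Surj ω′ × SH ns ω′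

Tie : Vec (Fin r) n → Set
Tie γ = ∃₂ λ k l → k F.< l × lookup γ k ≡ lookup γ l

CrossAscent : ∀ ns → Vec (Fin r) (sum ns) → Set
CrossAscent ns γ = ∃₂ λ k l → block ns k < block ns l × lookup γ k F.< lookup γ l

tie? : (γ : Vec (Fin r) n) → Dec (Tie γ)
tie? γ = any? λ k → any? λ l → k F.<? l ×-dec lookup γ k F.≟ lookup γ l

crossAscent? : ∀ ns (γ : Vec (Fin r) (sum ns)) → Dec (CrossAscent ns γ)
crossAscent? ns γ = any? λ k → any? λ l → block ns k <? block ns l ×-dec lookup γ k F.<? lookup γ l

-- Split the tied value v = γ k = γ l: its positions up to k go to v + 1, the later ones stay
-- at v, and larger values move up by one.
split : ∀ ns (γ : Vec (Fin r) (sum ns)) → Surj (r , γ) → SH ns (r , γ) → Tie γ → SHCover ns (r , γ)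
split {r} ns γ surj sh (k , l , k<l , tie) =
  (ℕ.suc r , γ′) , subst (λ γ₀ → (r , γ₀) ⋖ (ℕ.suc r , γ′)) unsplit (down γ′ v surj′ descent) ,
  surj′ , SH-unpinch ns v γ′ (subst (λ γ₀ → SH ns (r , γ₀)) (sym unsplit) sh)
  where
  v : Fin r
  v = lookup γ k

  gap : ∀ {p} → Dec (p F.≤ k) → Fin (ℕ.suc r)
  gap (yes _) = inject₁ v
  gap (no _)  = suc v

  γ′ : Vec (Fin (ℕ.suc r)) (sum ns)
  γ′ = tabulate λ p → punchIn (gap (p F.≤? k)) (lookup γ p)

  lookup-γ′ : ∀ p → lookup γ′ p ≡ punchIn (gap (p F.≤? k)) (lookup γ p)
  lookup-γ′ = lookup∘tabulate _

  pinch-gap : ∀ {p} (d : Dec (p F.≤ k)) j → pinch v (punchIn (gap d) j) ≡ j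
  pinch-gap (yes _) = pinch-punchIn-inject₁ v
  pinch-gap (no _)  = pinch-punchIn-suc v

  unsplit : map (t v) γ′ ≡ γ
  unsplit = lookup-ext λ p → trans (lookup-map-t v γ′ p)
    (trans (cong (pinch v) (lookup-γ′ p)) (pinch-gap (p F.≤? k) (lookup γ p)))

  upper-≤k : ∀ {p j} (d : Dec (p F.≤ k)) → punchIn (gap d) j ≡ suc v → p F.≤ k
  upper-≤k (yes p≤k) _  = p≤k
  upper-≤k (no _)    eq = ⊥-elim (punchInᵢ≢i _ _ eq)

  lower->k : ∀ {p j} (d : Dec (p F.≤ k)) → punchIn (gap d) j ≡ inject₁ v → k F.< p
  lower->k (yes _)   eq = ⊥-elim (punchInᵢ≢i _ _ eq)
  lower->k (no p≰k)  _  = ℕ.≰⇒> p≰k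

  descent : PreLt γ′ (suc v) (inject₁ v)
  descent p q γ′p γ′q = ℕ.≤-<-trans (upper-≤k (p F.≤? k) (trans (sym (lookup-γ′ p)) γ′p))
                                    (lower->k (q F.≤? k) (trans (sym (lookup-γ′ q)) γ′q))

  γ′k : lookup γ′ k ≡ suc v
  γ′k with k F.≤? k | lookup-γ′ k
  ... | yes _   | eq = trans eq (punchIn-inject₁-self v)
  ... | no k≰k  | _  = ⊥-elim (k≰k ℕ.≤-refl)

  γ′l : lookup γ′ l ≡ inject₁ v
  γ′l with l F.≤? k | lookup-γ′ l
  ... | yes l≤k | _  = ⊥-elim (ℕ.<⇒≱ k<l l≤k)
  ... | no _    | eq = trans eq (trans (cong (punchIn (suc v)) (sym tie)) (punchIn-suc-self v))

  surj′ : Surj (ℕ.suc r , γ′)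
  surj′ = Surj-unpinch v γ′ (subst (λ γ₀ → Surj (r , γ₀)) (sym unsplit) surj)
    (subst (_∈ γ′) γ′l (∈-lookup l γ′)) (subst (_∈ γ′) γ′k (∈-lookup k γ′))

¬Tie⇒injective : {γ : Vec (Fin r) n} → ¬ Tie γ → ∀ {k l} → lookup γ k ≡ lookup γ l → k ≡ l
¬Tie⇒injective ¬tie {k} {l} eq with F.<-cmp k l
... | tri< k<l _ _ = ⊥-elim (¬tie (k , l , k<l , eq))
... | tri≈ _ k≡l _ = k≡l
... | tri> _ _ l<k = ⊥-elim (¬tie (l , k , l<k , sym eq))

-- As γ is injective, the merged values are taken only at p and q, which lie in different blocks.
merge : ∀ ns (γ : Vec (Fin r) (sum ns)) → Surj (r , γ) → SH ns (r , γ) → ¬ Tie γ →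
        ∀ {p q} → values (r , γ) q ≡ ℕ.suc (values (r , γ) p) → block ns p < block ns q →
        SHCover ns (r , γ)
merge {ℕ.zero}  ns γ _ _ _ {p} _ _ with lookup γ p
... | ()
merge {ℕ.suc r} ns γ surj sh ¬tie {p} {q} adj bp<bq with adjacent⇒pinched adj
... | i , γp , γq = (r , map (t i) γ) , up γ i surj ascent , Surj-map (t-onto i) γ surj , sh′
  where
  at-p : ∀ {k} → lookup γ k ≡ inject₁ i → k ≡ p
  at-p γk = ¬Tie⇒injective {γ = γ} ¬tie (trans γk (sym γp))

  at-q : ∀ {l} → lookup γ l ≡ suc i → l ≡ q
  at-q γl = ¬Tie⇒injective {γ = γ} ¬tie (trans γl (sym γq))

  ascent : PreLt γ (inject₁ i) (suc i)
  ascent k l γk γl with at-p γk | at-q γl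
  ... | refl | refl = block-reflects-< ns bp<bq

  sh′ : SH ns (r , map (t i) γ)
  sh′ k l k<l same rewrite lookup-map-t i γ k | lookup-map-t i γ l =
    pinch-mono-< i (sh k l k<l same) λ (γk , γl) →
      ℕ.<-irrefl (subst₂ (λ a b → block ns a ≡ block ns b) (at-p γk) (at-q γl) same) bp<bq

-- Walk up through the values from γ k to γ l: b has to increase at some step.
adjacent-ascent : {γ : Vec (Fin r) n} → Surj (r , γ) → (b : Fin n → ℕ) →
                  ∀ {k l} → lookup γ k F.< lookup γ l → b k < b l →
                  ∃₂ λ p q → values (r , γ) q ≡ ℕ.suc (values (r , γ) p) × b p < b q
adjacent-ascent {r = r} {n = n} {γ = γ} surj b {k} {l} γk<γl =
  walk (val l ∸ ℕ.suc (val k)) (trans (sym (ℕ.m∸n+n≡m γk<γl)) (ℕ.+-suc _ _))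
  where
  val : Fin n → ℕ
  val = values (r , γ)

  next<r : ∀ d {k} → val l ≡ ℕ.suc (ℕ.suc d + val k) → ℕ.suc (val k) < r
  next<r d {k} eq = ℕ.<-≤-trans (subst (ℕ.suc (val k) <_) (sym eq) (s≤s (s≤s (ℕ.m≤n+m _ d))))
                                (ℕ.<⇒≤ (toℕ<n (lookup γ l)))

  walk : ∀ d {k} → val l ≡ ℕ.suc (d + val k) → b k < b l →
         ∃₂ λ p q → val q ≡ ℕ.suc (val p) × b p < b q
  walk ℕ.zero        eq bk<bl = _ , _ , eq , bk<bl
  walk (ℕ.suc d) {k} eq bk<bl with preimage surj (fromℕ< (next<r d eq))
  ... | m , γm with b k <? b m | trans (cong toℕ γm) (toℕ-fromℕ< _)
  ...   | yes bk<bm | val-m = k , m , val-m , bk<bm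
  ...   | no bk≮bm  | val-m = walk d eq′ (ℕ.≤-<-trans (ℕ.≮⇒≥ bk≮bm) bk<bl)
    where
    open ≡-Reasoning
    eq′ : val l ≡ ℕ.suc (d + val m)
    eq′ = begin
      val l                      ≡⟨ eq ⟩
      ℕ.suc (ℕ.suc (d + val k))  ≡⟨ cong ℕ.suc (ℕ.+-suc d (val k)) ⟨
      ℕ.suc (d + ℕ.suc (val k))  ≡⟨ cong (λ x → ℕ.suc (d + x)) val-m ⟨
      ℕ.suc (d + val m)          ∎

SHCover-or-ξ : ∀ ns {ω : Map (sum ns)} → Surj ω → SH ns ω → SHCover ns ω ⊎ ω ≡ ξ ns
SHCover-or-ξ ns {r , γ} surj sh with tie? γ | crossAscent? ns γ
... | yes tie  | _ = inj₁ (split ns γ surj sh tie)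
... | no ¬tie  | yes (_ , _ , bk<bl , γk<γl) with adjacent-ascent surj (block ns) γk<γl bk<bl
...   | _ , _ , adj , bp<bq = inj₁ (merge ns γ surj sh ¬tie adj bp<bq)
SHCover-or-ξ ns {r , γ} surj sh | no ¬tie | no ¬cross = inj₂ (ξ-unique ns surj ordered)
  where
  ordered : BlockOrdered (block ns) (values (r , γ))
  ordered {k} {l} k<l = sh k l k<l , λ diff → F.≤∧≢⇒<
    (ℕ.≮⇒≥ λ γk<γl → ¬cross (k , l , ℕ.≤∧≢⇒< (blk-mono ns (ℕ.<⇒≤ k<l)) diff , γk<γl))
    (λ γl≡γk → ¬tie (k , l , k<l , sym γl≡γk))

SH⇒≤Bξ : ∀ ns {ω : Map (sum ns)} → Surj ω → SH ns ω → ω ≤B ξ ns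
SH⇒≤Bξ ns {ω} = go (<-wellFounded (ascents ω))
  where
  go : ∀ {ω} → Acc _<_ (ascents ω) → Surj ω → SH ns ω → ω ≤B ξ ns
  go (acc rec) surj sh with SHCover-or-ξ ns surj sh
  ... | inj₂ refl = ε
  ... | inj₁ (_ , ω⋖ω′ , surj′ , sh′) = ω⋖ω′ ◅ go (rec (⋖-decreases ω⋖ω′)) surj′ sh′

≤Bξ⇒SH : ∀ ns {ω : Map (sum ns)} → ω ≤B ξ ns → SH ns ω
≤Bξ⇒SH ns ε              = SH-ξ ns
≤Bξ⇒SH ns (ω⋖ω′ ◅ ω′≤ξ) = SH-⊑ ns (⋖⇒⊑ ω⋖ω′) (≤Bξ⇒SH ns ω′≤ξ)

mainTheorem6 : (ns : List ℕ) → 1 ≤ sum ns → (ω : Map (sum ns)) → Surj ω →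
    (SH ns ω ⇔ ω ≤B ξ ns)
mainTheorem6 ns _ ω surj = mk⇔ (SH⇒≤Bξ ns surj) (≤Bξ⇒SH ns)
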